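{- The call-by-name $\lambda\Box$-calculus is strongly normalizing with respect to $\to_n$: for every well-typed term $M$ (i.e. $\Gamma\vdash M:\tau$ is derivable for some $\Gamma,\tau$) there is no infinite reduction sequence $M\to_n M_1\to_n M_2\to_n\cdots$.
   Context: Types: $\sigma ::= p \mid \sigma\supset\sigma \mid \Box\sigma$, where $p$ ranges over type constants. Terms: $M ::= c \mid x \mid \lambda x^{\sigma}.M \mid MM \mid \mathbf{box}_{x_1^{\sigma_1},\dots,x_n^{\sigma_n}}(N_1,\dots,N_n;M)$ ($n\ge0$), where $c$ ranges over constants (each with a fixed type) and $x$ over variables. In the box term the $x_i$ are bound in $M$, and the free variables of the box term are those of the $N_i$. Terms are up to $\alpha$-equivalence. $\vec x$ denotes a sequence and $|\vec x|$ its length. Typing rules: - $\Gamma\vdash c^\tau:\tau$; - $\Gamma,x:\tau,\Gamma'\vdash x:\tau$; - from $\Gamma,x:\sigma\vdash M:\tau$ infer $\Gamma\vdash\lambda x^\sigma.M:\sigma\supset\tau$; - from $\Gamma\vdash M:\sigma\supset\tau$ and $\Gamma\vdash N:\sigma$ infer $\Gamma\vdash MN:\tau$; - from $x_1:\sigma_1,\dots,x_n:\sigma_n\vdash M:\tau$ and $\Gamma\vdash N_i:\Box\sigma_i$ for all $i$, infer $\Gamma\vdash\mathbf{box}_{x_1^{\sigma_1},\dots,x_n^{\sigma_n}}(N_1,\dots,N_n;M):\Box\tau$. $\to_n$ is the closure under arbitrary term contexts of: - $(\lambda x.M)N\to M[x:=N]$; - $\lambda x.Mx\to M$ if $x\notin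 FV(M)$; - $\mathbf{box}_x(M;x)\to M$; - $\mathbf{box}_{\vec w,x,\vec z}(\vec P,\mathbf{box}_{\vec y}(\vec L;N),\vec Q;M)\to\mathbf{box}_{\vec w,\vec y,\vec z}(\vec P,\vec L,\vec Q;M[x:=N])$ with $|\vec w|=|\vec P|$. -}

module Defs where

open import Data.Nat using (ℕ; zero; suc; _+_)
open import Data.Fin using (Fin; zero; suc; _↑ˡ_; _↑ʳ_; splitAt)
open import Data.Vec using (Vec; []; _∷_; _++_; lookup)
open import Data.Sum using (inj₁; inj₂)

infixr 20 _⊃_
data Ty (P : Set) : Set where
  base : P → Ty P
  _⊃_  : Ty P → Ty P → Ty P
  □_   : Ty P → Ty P

module Calculus (P : Set) (C : Set) (cty : C → Ty P) where

  -- Tm n : terms whose free variables are among n variables.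
  -- lam σ M : λ x^σ. M  (x is variable zero in M).
  -- box σs Ns M : box_{x_1^σ_1..x_k^σ_k}(N_1..N_k; M), where M lives in a
  --   scope consisting exactly of x_1..x_k (variable i of M is x_{i+1}),
  --   so the free variables of the box are those of the N_i.
  data Tm (n : ℕ) : Set where
    con : C → Tm n
    var : Fin n → Tm n
    lam : Ty P → Tm (suc n) → Tm n
    app : Tm n → Tm n → Tm n
    box : {k : ℕ} → Vec (Ty P) k → Vec (Tm n) k → Tm k → Tm n

  ext : {m n : ℕ} → (Fin m → Fin n) → Fin (suc m) → Fin (suc n)
  ext ρ zero    = zero
  ext ρ (suc i) = suc (ρ i)

  mutual
    rename : {m n : ℕ} → (Fin m → Fin n) → Tm m → Tm n
    rename ρ (con c)       = con c
    rename ρ (var i)       = var (ρ i)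
    rename ρ (lam σ M)     = lam σ (rename (ext ρ) M)
    rename ρ (app M N)     = app (rename ρ M) (rename ρ N)
    rename ρ (box σs Ns M) = box σs (renameVec ρ Ns) M

    renameVec : {m n k : ℕ} → (Fin m → Fin n) → Vec (Tm m) k → Vec (Tm n) k
    renameVec ρ []       = []
    renameVec ρ (N ∷ Ns) = rename ρ N ∷ renameVec ρ Ns

  weaken : {n : ℕ} → Tm n → Tm (suc n)
  weaken = rename suc

  exts : {m n : ℕ} → (Fin m → Tm n) → Fin (suc m) → Tm (suc n)
  exts s zero    = var zero
  exts s (suc i) = weaken (s i)

  mutual
    subst : {m n : ℕ} → (Fin m → Tm n) → Tm m → Tm n
    subst s (con c)       = con c
    subst s (var i)       = s i
    subst s (lam σ M)     = lam σ (subst (exts s) M)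
    subst s (app M N)     = app (subst s M) (subst s N)
    subst s (box σs Ns M) = box σs (substVec s Ns) M

    substVec : {m n k : ℕ} → (Fin m → Tm n) → Vec (Tm m) k → Vec (Tm n) k
    substVec s []       = []
    substVec s (N ∷ Ns) = subst s N ∷ substVec s Ns

  sub0 : {n : ℕ} → Tm n → Fin (suc n) → Tm n
  sub0 N zero    = N
  sub0 N (suc i) = var i

  _[0:=_] : {n : ℕ} → Tm (suc n) → Tm n → Tm n
  M [0:= N ] = subst (sub0 N) M

  -- Substitution used by the box-flattening rule: the box scope
  -- w_1..w_a, x, z_1..z_b becomes w_1..w_a, y_1..y_j, z_1..z_b,
  -- and x is replaced by N (a term over y_1..y_j).
  flatSub : (a j b : ℕ) → Tm j → Fin (a + suc b) → Tm ((a + j) + b)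
  flatSub a j b N i with splitAt a i
  ... | inj₁ w       = var ((w ↑ˡ j) ↑ˡ b)
  ... | inj₂ zero    = rename (λ k → (a ↑ʳ k) ↑ˡ b) N
  ... | inj₂ (suc z) = var ((a + j) ↑ʳ z)

  infix 4 _⟶_ _⟶v_
  mutual
    data _⟶_ {n : ℕ} : Tm n → Tm n → Set where
      β     : ∀ {σ M N} → app (lam σ M) N ⟶ M [0:= N ]
      η     : ∀ {σ M} → lam σ (app (weaken M) (var zero)) ⟶ M
      boxId : ∀ {σ M} → box (σ ∷ []) (M ∷ []) (var zero) ⟶ M
      boxFlat : ∀ {a j b} (ws : Vec (Ty P) a) (σ : Ty P) (zs : Vec (Ty P) b)
                  (Ps : Vec (Tm n) a) (τs : Vec (Ty P) j) (Ls : Vec (Tm n) j)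
                  (N : Tm j) (Qs : Vec (Tm n) b) (M : Tm (a + suc b)) →
                box (ws ++ (σ ∷ zs)) (Ps ++ (box τs Ls N ∷ Qs)) M
                  ⟶ box ((ws ++ τs) ++ zs) ((Ps ++ Ls) ++ Qs)
                        (subst (flatSub a j b N) M)
      ξlam  : ∀ {σ M M'} → M ⟶ M' → lam σ M ⟶ lam σ M'
      ξappl : ∀ {M M' N} → M ⟶ M' → app M N ⟶ app M' N
      ξappr : ∀ {M N N'} → N ⟶ N' → app M N ⟶ app M N'
      ξboxArgs : ∀ {k} {σs : Vec (Ty P) k} {Ns Ns' M} →
                 Ns ⟶v Ns' → box σs Ns M ⟶ box σs Ns' M
      ξboxBody : ∀ {k} {σs : Vec (Ty P) k} {Ns} {M M' : Tm k} →
                 M ⟶ M' → box σs Ns M ⟶ box σs Ns M'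

    data _⟶v_ {n : ℕ} : {k : ℕ} → Vec (Tm n) k → Vec (Tm n) k → Set where
      here  : ∀ {k N N'} {Ns : Vec (Tm n) k} → N ⟶ N' → (N ∷ Ns) ⟶v (N' ∷ Ns)
      there : ∀ {k N} {Ns Ns' : Vec (Tm n) k} → Ns ⟶v Ns' → (N ∷ Ns) ⟶v (N ∷ Ns')

  infix 4 _⊢_∶_
  data _⊢_∶_ {n : ℕ} (Γ : Vec (Ty P) n) : Tm n → Ty P → Set where
    tcon : ∀ c → Γ ⊢ con c ∶ cty c
    tvar : ∀ i → Γ ⊢ var i ∶ lookup Γ i
    tlam : ∀ {σ τ M} → (σ ∷ Γ) ⊢ M ∶ τ → Γ ⊢ lam σ M ∶ σ ⊃ τ
    tapp : ∀ {σ τ M N} → Γ ⊢ M ∶ σ ⊃ τ → Γ ⊢ N ∶ σ → Γ ⊢ app M N ∶ τ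
    tbox : ∀ {k} {σs : Vec (Ty P) k} {Ns M τ} →
           σs ⊢ M ∶ τ →
           (∀ i → Γ ⊢ lookup Ns i ∶ □ (lookup σs i)) →
           Γ ⊢ box σs Ns M ∶ □ τ

-- Tait–Girard reducibility inside an outer induction on box-nesting depth. A box body
-- lives in its own scope and the flattening rule substitutes one body into another, so
-- reducibility at □ τ cannot be built from reducibility at τ. Instead a term is reducible
-- at □ τ when every box it reduces to has reducible arguments and a typed body of smaller
-- nesting depth, which is strongly normalising by the induction hypothesis; reduction never
-- increases nesting depth. A box's argument list can change only by reducing one argument
-- or by splicing in the arguments of an argument that is itself a box, and this is a
-- well-founded process once every argument is reducible.
module Submission where

open import Defs
open import Data.Nat using (ℕ; zero; suc; _+_; _≤_; _<_; _⊔_)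
open import Data.Nat.Induction using (<-rec)
open import Data.Nat.Properties using (m≤m⊔n; m≤n⊔m; ⊔-lub; <-≤-trans)
open import Data.Fin using (Fin; zero; suc; _↑ˡ_; _↑ʳ_; splitAt)
open import Data.Fin.Properties using (splitAt⁻¹-↑ˡ; splitAt⁻¹-↑ʳ)
open import Data.List using (List; []; _∷_) renaming (_++_ to _++ₗ_)
open import Data.Vec using (Vec; []; _∷_; _++_; lookup; toList)
open import Data.Vec.Properties using (lookup-++ˡ; lookup-++ʳ; toList-++)
open import Data.Vec.Relation.Binary.Pointwise.Inductive as Pointwise using (Pointwise; []; _∷_)
open import Data.Vec.Relation.Binary.Pointwise.Extensional as Extensional using (extensional⇒inductive)
open import Data.Vec.Relation.Unary.All using (All; []; _∷_)
import Data.Vec.Relation.Unary.All.Properties as All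
open import Data.Sum using (inj₁; inj₂)
open import Data.Product using (Σ; ∃-syntax; _,_; _×_)
open import Data.Empty using (⊥-elim)
open import Function using (_∘_; flip)
open import Induction.WellFounded using (Acc; acc)
open import Induction.InfiniteDescent using (descent∧acc⇒unsatisfiable)
open import Relation.Nullary using (¬_)
open import Relation.Binary.PropositionalEquality
  using (_≡_; _≗_; refl; sym; trans; cong; cong₂; module ≡-Reasoning)
  renaming (subst to transport)

private variable l m n k : ℕ

lookup⇒Pointwise : {A B : Set} {R : A → B → Set} {xs : Vec A n} {ys : Vec B n} →
                   (∀ i → R (lookup xs i) (lookup ys i)) → Pointwise R xs ys
lookup⇒Pointwise R-lookup = extensional⇒inductive (Extensional.ext R-lookup)

module _ {P C : Set} {cty : C → Ty P} where
  open Calculus P C cty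

  Ren : ℕ → ℕ → Set
  Ren m n = Fin m → Fin n

  Sub : ℕ → ℕ → Set
  Sub m n = Fin m → Tm n

  ext-cong : {ρ ρ' : Ren m n} → ρ ≗ ρ' → ext ρ ≗ ext ρ'
  ext-cong e zero    = refl
  ext-cong e (suc i) = cong suc (e i)

  mutual
    rename-cong : {ρ ρ' : Ren m n} → ρ ≗ ρ' → rename ρ ≗ rename ρ'
    rename-cong e (con c)       = refl
    rename-cong e (var i)       = cong var (e i)
    rename-cong e (lam σ M)     = cong (lam σ) (rename-cong (ext-cong e) M)
    rename-cong e (app M N)     = cong₂ app (rename-cong e M) (rename-cong e N)
    rename-cong e (box σs Ns M) = cong (λ Ns → box σs Ns M) (renameVec-cong e Ns)

    renameVec-cong : {ρ ρ' : Ren m n} → ρ ≗ ρ' → renameVec {k = k} ρ ≗ renameVec ρ'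
    renameVec-cong e []       = refl
    renameVec-cong e (N ∷ Ns) = cong₂ _∷_ (rename-cong e N) (renameVec-cong e Ns)

  exts-cong : {s s' : Sub m n} → s ≗ s' → exts s ≗ exts s'
  exts-cong e zero    = refl
  exts-cong e (suc i) = cong weaken (e i)

  mutual
    subst-cong : {s s' : Sub m n} → s ≗ s' → subst s ≗ subst s'
    subst-cong e (con c)       = refl
    subst-cong e (var i)       = e i
    subst-cong e (lam σ M)     = cong (lam σ) (subst-cong (exts-cong e) M)
    subst-cong e (app M N)     = cong₂ app (subst-cong e M) (subst-cong e N)
    subst-cong e (box σs Ns M) = cong (λ Ns → box σs Ns M) (substVec-cong e Ns)

    substVec-cong : {s s' : Sub m n} → s ≗ s' → substVec {k = k} s ≗ substVec s'
    substVec-cong e []       = refl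
    substVec-cong e (N ∷ Ns) = cong₂ _∷_ (subst-cong e N) (substVec-cong e Ns)

  mutual
    rename-rename : (ρ : Ren m n) (ρ' : Ren l m) (M : Tm l) →
                    rename ρ (rename ρ' M) ≡ rename (ρ ∘ ρ') M
    rename-rename ρ ρ' (con c)       = refl
    rename-rename ρ ρ' (var i)       = refl
    rename-rename ρ ρ' (lam σ M)     =
      cong (lam σ) (trans (rename-rename (ext ρ) (ext ρ') M) (rename-cong ext-∘ M))
      where ext-∘ : ext ρ ∘ ext ρ' ≗ ext (ρ ∘ ρ')
            ext-∘ zero    = refl
            ext-∘ (suc i) = refl
    rename-rename ρ ρ' (app M N)     = cong₂ app (rename-rename ρ ρ' M) (rename-rename ρ ρ' N)
    rename-rename ρ ρ' (box σs Ns M) = cong (λ Ns → box σs Ns M) (renameVec-renameVec ρ ρ' Ns)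

    renameVec-renameVec : (ρ : Ren m n) (ρ' : Ren l m) (Ns : Vec (Tm l) k) →
                          renameVec ρ (renameVec ρ' Ns) ≡ renameVec (ρ ∘ ρ') Ns
    renameVec-renameVec ρ ρ' []       = refl
    renameVec-renameVec ρ ρ' (N ∷ Ns) = cong₂ _∷_ (rename-rename ρ ρ' N) (renameVec-renameVec ρ ρ' Ns)

  mutual
    subst-rename : (s : Sub m n) (ρ : Ren l m) (M : Tm l) →
                   subst s (rename ρ M) ≡ subst (s ∘ ρ) M
    subst-rename s ρ (con c)       = refl
    subst-rename s ρ (var i)       = refl
    subst-rename s ρ (lam σ M)     =
      cong (lam σ) (trans (subst-rename (exts s) (ext ρ) M) (subst-cong exts-ext M))
      where exts-ext : exts s ∘ ext ρ ≗ exts (s ∘ ρ)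
            exts-ext zero    = refl
            exts-ext (suc i) = refl
    subst-rename s ρ (app M N)     = cong₂ app (subst-rename s ρ M) (subst-rename s ρ N)
    subst-rename s ρ (box σs Ns M) = cong (λ Ns → box σs Ns M) (substVec-renameVec s ρ Ns)

    substVec-renameVec : (s : Sub m n) (ρ : Ren l m) (Ns : Vec (Tm l) k) →
                         substVec s (renameVec ρ Ns) ≡ substVec (s ∘ ρ) Ns
    substVec-renameVec s ρ []       = refl
    substVec-renameVec s ρ (N ∷ Ns) = cong₂ _∷_ (subst-rename s ρ N) (substVec-renameVec s ρ Ns)

  mutual
    rename-subst : (ρ : Ren m n) (s : Sub l m) (M : Tm l) →
                   rename ρ (subst s M) ≡ subst (rename ρ ∘ s) M
    rename-subst ρ s (con c)       = refl
    rename-subst ρ s (var i)       = refl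
    rename-subst ρ s (lam σ M)     =
      cong (lam σ) (trans (rename-subst (ext ρ) (exts s) M) (subst-cong ext-exts M))
      where ext-exts : rename (ext ρ) ∘ exts s ≗ exts (rename ρ ∘ s)
            ext-exts zero    = refl
            ext-exts (suc i) = trans (rename-rename (ext ρ) suc (s i)) (sym (rename-rename suc ρ (s i)))
    rename-subst ρ s (app M N)     = cong₂ app (rename-subst ρ s M) (rename-subst ρ s N)
    rename-subst ρ s (box σs Ns M) = cong (λ Ns → box σs Ns M) (renameVec-substVec ρ s Ns)

    renameVec-substVec : (ρ : Ren m n) (s : Sub l m) (Ns : Vec (Tm l) k) →
                         renameVec ρ (substVec s Ns) ≡ substVec (rename ρ ∘ s) Ns
    renameVec-substVec ρ s []       = refl
    renameVec-substVec ρ s (N ∷ Ns) = cong₂ _∷_ (rename-subst ρ s N) (renameVec-substVec ρ s Ns)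

  mutual
    subst-subst : (s : Sub m n) (s' : Sub l m) (M : Tm l) →
                  subst s (subst s' M) ≡ subst (subst s ∘ s') M
    subst-subst s s' (con c)       = refl
    subst-subst s s' (var i)       = refl
    subst-subst s s' (lam σ M)     =
      cong (lam σ) (trans (subst-subst (exts s) (exts s') M) (subst-cong exts-exts M))
      where exts-exts : subst (exts s) ∘ exts s' ≗ exts (subst s ∘ s')
            exts-exts zero    = refl
            exts-exts (suc i) = trans (subst-rename (exts s) suc (s' i)) (sym (rename-subst suc s (s' i)))
    subst-subst s s' (app M N)     = cong₂ app (subst-subst s s' M) (subst-subst s s' N)
    subst-subst s s' (box σs Ns M) = cong (λ Ns → box σs Ns M) (substVec-substVec s s' Ns)

    substVec-substVec : (s : Sub m n) (s' : Sub l m) (Ns : Vec (Tm l) k) →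
                        substVec s (substVec s' Ns) ≡ substVec (subst s ∘ s') Ns
    substVec-substVec s s' []       = refl
    substVec-substVec s s' (N ∷ Ns) = cong₂ _∷_ (subst-subst s s' N) (substVec-substVec s s' Ns)

  mutual
    subst-var : (M : Tm n) → subst var M ≡ M
    subst-var (con c)       = refl
    subst-var (var i)       = refl
    subst-var (lam σ M)     = cong (lam σ) (trans (subst-cong exts-var M) (subst-var M))
      where exts-var : exts var ≗ var
            exts-var zero    = refl
            exts-var (suc i) = refl
    subst-var (app M N)     = cong₂ app (subst-var M) (subst-var N)
    subst-var (box σs Ns M) = cong (λ Ns → box σs Ns M) (substVec-var Ns)

    substVec-var : (Ns : Vec (Tm n) k) → substVec var Ns ≡ Ns
    substVec-var []       = refl
    substVec-var (N ∷ Ns) = cong₂ _∷_ (subst-var N) (substVec-var Ns)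

  infixr 5 _∷ₛ_
  _∷ₛ_ : Tm n → Sub m n → Sub (suc m) n
  (N ∷ₛ s) zero    = N
  (N ∷ₛ s) (suc i) = s i

  weaken-[0:=] : (M N : Tm n) → weaken M [0:= N ] ≡ M
  weaken-[0:=] M N = trans (subst-rename (sub0 N) suc M) (subst-var M)

  subst-exts-weaken : (s : Sub m n) (M : Tm m) → subst (exts s) (weaken M) ≡ weaken (subst s M)
  subst-exts-weaken s M = trans (subst-rename (exts s) suc M) (sym (rename-subst suc s M))

  subst-exts-[0:=] : (s : Sub m n) (N : Tm n) (M : Tm (suc m)) →
                     subst (exts s) M [0:= N ] ≡ subst (N ∷ₛ s) M
  subst-exts-[0:=] s N M = trans (subst-subst (sub0 N) (exts s) M) (subst-cong sub0-exts M)
    where sub0-exts : subst (sub0 N) ∘ exts s ≗ N ∷ₛ s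
          sub0-exts zero    = refl
          sub0-exts (suc i) = weaken-[0:=] (s i) N

  subst-[0:=] : (s : Sub m n) (N : Tm m) (M : Tm (suc m)) →
                subst s (M [0:= N ]) ≡ subst (exts s) M [0:= subst s N ]
  subst-[0:=] s N M = begin
    subst s (M [0:= N ])              ≡⟨ subst-subst s (sub0 N) M ⟩
    subst (subst s ∘ sub0 N) M        ≡⟨ subst-cong s∘sub0 M ⟩
    subst (subst s N ∷ₛ s) M          ≡⟨ subst-exts-[0:=] s (subst s N) M ⟨
    subst (exts s) M [0:= subst s N ] ∎
    where open ≡-Reasoning
          s∘sub0 : subst s ∘ sub0 N ≗ subst s N ∷ₛ s
          s∘sub0 zero    = refl
          s∘sub0 (suc i) = refl

  substVec-++ : ∀ {a b} (s : Sub m n) (Ns : Vec (Tm m) a) (Ns' : Vec (Tm m) b) →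
                substVec s (Ns ++ Ns') ≡ substVec s Ns ++ substVec s Ns'
  substVec-++ s []       Ns' = refl
  substVec-++ s (N ∷ Ns) Ns' = cong (subst s N ∷_) (substVec-++ s Ns Ns')

  lookup-substVec : (s : Sub m n) (Ns : Vec (Tm m) k) (i : Fin k) →
                    lookup (substVec s Ns) i ≡ subst s (lookup Ns i)
  lookup-substVec s (N ∷ Ns) zero    = refl
  lookup-substVec s (N ∷ Ns) (suc i) = lookup-substVec s Ns i

  lookup-renameVec : (ρ : Ren m n) (Ns : Vec (Tm m) k) (i : Fin k) →
                     lookup (renameVec ρ Ns) i ≡ rename ρ (lookup Ns i)
  lookup-renameVec ρ (N ∷ Ns) zero    = refl
  lookup-renameVec ρ (N ∷ Ns) (suc i) = lookup-renameVec ρ Ns i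

  mutual
    ⟶-subst : (s : Sub m n) {M M' : Tm m} → M ⟶ M' → subst s M ⟶ subst s M'
    ⟶-subst s (β {σ} {M} {N}) =
      transport (app (lam σ (subst (exts s) M)) (subst s N) ⟶_) (sym (subst-[0:=] s N M)) β
    ⟶-subst s (η {σ} {M}) =
      transport (λ M↑ → lam σ (app M↑ (var zero)) ⟶ subst s M) (sym (subst-exts-weaken s M)) η
    ⟶-subst s boxId = boxId
    ⟶-subst s (boxFlat ws σ zs Ps τs Ls N Qs M)
      rewrite substVec-++ s Ps (box τs Ls N ∷ Qs) | substVec-++ s (Ps ++ Ls) Qs | substVec-++ s Ps Ls
      = boxFlat ws σ zs (substVec s Ps) τs (substVec s Ls) N (substVec s Qs) M
    ⟶-subst s (ξlam r)     = ξlam (⟶-subst (exts s) r)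
    ⟶-subst s (ξappl r)    = ξappl (⟶-subst s r)
    ⟶-subst s (ξappr r)    = ξappr (⟶-subst s r)
    ⟶-subst s (ξboxArgs r) = ξboxArgs (⟶v-subst s r)
    ⟶-subst s (ξboxBody r) = ξboxBody r

    ⟶v-subst : (s : Sub m n) {Ns Ns' : Vec (Tm m) k} → Ns ⟶v Ns' → substVec s Ns ⟶v substVec s Ns'
    ⟶v-subst s (here r)  = here (⟶-subst s r)
    ⟶v-subst s (there r) = there (⟶v-subst s r)

  _⟵_ : Tm n → Tm n → Set
  M' ⟵ M = M ⟶ M'

  SN : Tm n → Set
  SN = Acc _⟵_

  SN-inverse-image : (f : Tm m → Tm n) → (∀ {M M'} → M ⟶ M' → f M ⟶ f M') →
                     ∀ {M} → SN (f M) → SN M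
  SN-inverse-image f f-⟶ (acc rs) = acc λ r → SN-inverse-image f f-⟶ (rs (f-⟶ r))

  SN-subst⁻ : (s : Sub m n) {M : Tm m} → SN (subst s M) → SN M
  SN-subst⁻ s = SN-inverse-image (subst s) (⟶-subst s)

  SN-appˡ : {M N : Tm n} → SN (app M N) → SN M
  SN-appˡ {N = N} = SN-inverse-image (λ M → app M N) ξappl

  InfiniteReductionFrom : Tm n → Set
  InfiniteReductionFrom M = Σ (ℕ → Tm _) λ f → (f zero ≡ M) × (∀ i → f i ⟶ f (suc i))

  SN⇒¬InfiniteReductionFrom : {M : Tm n} → SN M → ¬ InfiniteReductionFrom M
  SN⇒¬InfiniteReductionFrom = descent∧acc⇒unsatisfiable descent
    where descent : ∀ {M} → InfiniteReductionFrom M → ∃[ M' ] M' ⟵ M × InfiniteReductionFrom M'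
          descent (f , refl , f⟶) = f 1 , f⟶ 0 , f ∘ suc , refl , f⟶ ∘ suc

  Ctx : ℕ → Set
  Ctx = Vec (Ty P)

  infix 4 _⊢ᵣ_∶_ _⊢ₛ_∶_ _⊢⃗_∶□_

  _⊢ᵣ_∶_ : Ctx n → Ren m n → Ctx m → Set
  Δ ⊢ᵣ ρ ∶ Γ = ∀ i → lookup Δ (ρ i) ≡ lookup Γ i

  _⊢ₛ_∶_ : Ctx n → Sub m n → Ctx m → Set
  Δ ⊢ₛ s ∶ Γ = ∀ i → Δ ⊢ s i ∶ lookup Γ i

  ⊢var : {Γ : Ctx n} {i : Fin n} {τ : Ty P} → lookup Γ i ≡ τ → Γ ⊢ var i ∶ τ
  ⊢var refl = tvar _

  ⊢ᵣ-ext : {Γ : Ctx m} {Δ : Ctx n} {ρ : Ren m n} (σ : Ty P) → Δ ⊢ᵣ ρ ∶ Γ → (σ ∷ Δ) ⊢ᵣ ext ρ ∶ (σ ∷ Γ)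
  ⊢ᵣ-ext σ ⊢ρ zero    = refl
  ⊢ᵣ-ext σ ⊢ρ (suc i) = ⊢ρ i

  ⊢-rename : {Γ : Ctx m} {Δ : Ctx n} {ρ : Ren m n} {M : Tm m} {τ : Ty P} →
             Δ ⊢ᵣ ρ ∶ Γ → Γ ⊢ M ∶ τ → Δ ⊢ rename ρ M ∶ τ
  ⊢-rename ⊢ρ (tcon c)     = tcon c
  ⊢-rename ⊢ρ (tvar i)     = ⊢var (⊢ρ i)
  ⊢-rename ⊢ρ (tlam ⊢M)    = tlam (⊢-rename (⊢ᵣ-ext _ ⊢ρ) ⊢M)
  ⊢-rename ⊢ρ (tapp ⊢M ⊢N) = tapp (⊢-rename ⊢ρ ⊢M) (⊢-rename ⊢ρ ⊢N)
  ⊢-rename {Δ = Δ} {ρ} ⊢ρ (tbox {Ns = Ns} ⊢M ⊢Ns) =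
    tbox ⊢M λ i → transport (λ N → Δ ⊢ N ∶ _) (sym (lookup-renameVec ρ Ns i)) (⊢-rename ⊢ρ (⊢Ns i))

  ⊢-subst : {Γ : Ctx m} {Δ : Ctx n} {s : Sub m n} {M : Tm m} {τ : Ty P} →
            Δ ⊢ₛ s ∶ Γ → Γ ⊢ M ∶ τ → Δ ⊢ subst s M ∶ τ
  ⊢-subst ⊢s (tcon c)     = tcon c
  ⊢-subst ⊢s (tvar i)     = ⊢s i
  ⊢-subst ⊢s (tlam ⊢M)    = tlam (⊢-subst ⊢exts ⊢M)
    where ⊢exts : (_ ∷ _) ⊢ₛ exts _ ∶ (_ ∷ _)
          ⊢exts zero    = tvar zero
          ⊢exts (suc i) = ⊢-rename (λ _ → refl) (⊢s i)
  ⊢-subst ⊢s (tapp ⊢M ⊢N) = tapp (⊢-subst ⊢s ⊢M) (⊢-subst ⊢s ⊢N)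
  ⊢-subst {Δ = Δ} {s} ⊢s (tbox {Ns = Ns} ⊢M ⊢Ns) =
    tbox ⊢M λ i → transport (λ N → Δ ⊢ N ∶ _) (sym (lookup-substVec s Ns i)) (⊢-subst ⊢s (⊢Ns i))

  ⊢-[0:=] : {Γ : Ctx n} {σ τ : Ty P} {M : Tm (suc n)} {N : Tm n} →
            (σ ∷ Γ) ⊢ M ∶ τ → Γ ⊢ N ∶ σ → Γ ⊢ M [0:= N ] ∶ τ
  ⊢-[0:=] ⊢M ⊢N = ⊢-subst ⊢sub0 ⊢M
    where ⊢sub0 : _ ⊢ₛ sub0 _ ∶ (_ ∷ _)
          ⊢sub0 zero    = ⊢N
          ⊢sub0 (suc i) = tvar i

  ⊢-rename⁻ : {Γ : Ctx m} {Δ : Ctx n} {ρ : Ren m n} (M : Tm m) {M' : Tm n} {τ : Ty P} →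
              Δ ⊢ᵣ ρ ∶ Γ → M' ≡ rename ρ M → Δ ⊢ M' ∶ τ → Γ ⊢ M ∶ τ
  ⊢-rename⁻ (con c)       ⊢ρ refl (tcon c)     = tcon c
  ⊢-rename⁻ (var i)       ⊢ρ refl (tvar _)     = ⊢var (sym (⊢ρ i))
  ⊢-rename⁻ (lam σ M)     ⊢ρ refl (tlam ⊢M)    = tlam (⊢-rename⁻ M (⊢ᵣ-ext σ ⊢ρ) refl ⊢M)
  ⊢-rename⁻ (app M N)     ⊢ρ refl (tapp ⊢M ⊢N) = tapp (⊢-rename⁻ M ⊢ρ refl ⊢M) (⊢-rename⁻ N ⊢ρ refl ⊢N)
  ⊢-rename⁻ {ρ = ρ} (box σs Ns M) ⊢ρ refl (tbox ⊢M ⊢Ns) =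
    tbox ⊢M λ i → ⊢-rename⁻ (lookup Ns i) ⊢ρ (lookup-renameVec ρ Ns i) (⊢Ns i)

  _⊢⃗_∶□_ : Ctx n → Vec (Tm n) k → Ctx k → Set
  Γ ⊢⃗ Ns ∶□ σs = Pointwise (λ σ N → Γ ⊢ N ∶ □ σ) σs Ns

  lookup⇒⊢⃗ : {Γ : Ctx n} {Ns : Vec (Tm n) k} {σs : Ctx k} →
              (∀ i → Γ ⊢ lookup Ns i ∶ □ lookup σs i) → Γ ⊢⃗ Ns ∶□ σs
  lookup⇒⊢⃗ = lookup⇒Pointwise

  flatSub-⊢ : ∀ {a j b} (ws : Ctx a) (σ : Ty P) (zs : Ctx b) (τs : Ctx j) {N : Tm j} →
              τs ⊢ N ∶ σ → (ws ++ τs) ++ zs ⊢ₛ flatSub a j b N ∶ ws ++ σ ∷ zs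
  flatSub-⊢ {a} {j} {b} ws σ zs τs ⊢N i with splitAt a i in eq
  ... | inj₁ w = ⊢var (begin
    lookup ((ws ++ τs) ++ zs) ((w ↑ˡ j) ↑ˡ b) ≡⟨ lookup-++ˡ (ws ++ τs) zs (w ↑ˡ j) ⟩
    lookup (ws ++ τs) (w ↑ˡ j)                ≡⟨ lookup-++ˡ ws τs w ⟩
    lookup ws w                               ≡⟨ lookup-++ˡ ws (σ ∷ zs) w ⟨
    lookup (ws ++ σ ∷ zs) (w ↑ˡ suc b)        ≡⟨ cong (lookup (ws ++ σ ∷ zs)) (splitAt⁻¹-↑ˡ eq) ⟩
    lookup (ws ++ σ ∷ zs) i                   ∎)
    where open ≡-Reasoning
  ... | inj₂ zero = transport (_ ⊢ _ ∶_) σ≡ (⊢-rename ⊢ρ ⊢N)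
    where σ≡ : σ ≡ lookup (ws ++ σ ∷ zs) i
          σ≡ = trans (sym (lookup-++ʳ ws (σ ∷ zs) zero)) (cong (lookup (ws ++ σ ∷ zs)) (splitAt⁻¹-↑ʳ eq))
          ⊢ρ : (ws ++ τs) ++ zs ⊢ᵣ (λ k → (a ↑ʳ k) ↑ˡ b) ∶ τs
          ⊢ρ k = trans (lookup-++ˡ (ws ++ τs) zs (a ↑ʳ k)) (lookup-++ʳ ws τs k)
  ... | inj₂ (suc z) = ⊢var (begin
    lookup ((ws ++ τs) ++ zs) ((a + j) ↑ʳ z) ≡⟨ lookup-++ʳ (ws ++ τs) zs z ⟩
    lookup zs z                              ≡⟨ lookup-++ʳ ws (σ ∷ zs) (suc z) ⟨
    lookup (ws ++ σ ∷ zs) (a ↑ʳ suc z)       ≡⟨ cong (lookup (ws ++ σ ∷ zs)) (splitAt⁻¹-↑ʳ eq) ⟩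
    lookup (ws ++ σ ∷ zs) i                  ∎)
    where open ≡-Reasoning

  mutual
    subject-reduction : {Γ : Ctx n} {M M' : Tm n} {τ : Ty P} → M ⟶ M' → Γ ⊢ M ∶ τ → Γ ⊢ M' ∶ τ
    subject-reduction β                          (tapp (tlam ⊢M) ⊢N)        = ⊢-[0:=] ⊢M ⊢N
    subject-reduction (η {M = M})                (tlam (tapp ⊢M (tvar _))) = ⊢-rename⁻ M (λ _ → refl) refl ⊢M
    subject-reduction boxId                      (tbox (tvar zero) ⊢Ns)     = ⊢Ns zero
    subject-reduction (boxFlat ws σ zs Ps τs Ls N Qs M) (tbox ⊢M ⊢Ns)
      with Pointwise.++⁻ ws Ps (lookup⇒⊢⃗ ⊢Ns)
    ... | ⊢Ps , tbox ⊢N ⊢Ls ∷ ⊢Qs =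
      tbox (⊢-subst (flatSub-⊢ ws σ zs τs ⊢N) ⊢M)
           (Pointwise.lookup (Pointwise.++⁺ (Pointwise.++⁺ ⊢Ps (lookup⇒⊢⃗ ⊢Ls)) ⊢Qs))
    subject-reduction (ξlam r)     (tlam ⊢M)     = tlam (subject-reduction r ⊢M)
    subject-reduction (ξappl r)    (tapp ⊢M ⊢N)  = tapp (subject-reduction r ⊢M) ⊢N
    subject-reduction (ξappr r)    (tapp ⊢M ⊢N)  = tapp ⊢M (subject-reduction r ⊢N)
    subject-reduction (ξboxArgs r) (tbox {σs = σs} ⊢M ⊢Ns) =
      tbox ⊢M (Pointwise.lookup (⟶v-subject-reduction {σs = σs} r (lookup⇒⊢⃗ ⊢Ns)))
    subject-reduction (ξboxBody r) (tbox ⊢M ⊢Ns) = tbox (subject-reduction r ⊢M) ⊢Ns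

    ⟶v-subject-reduction : {Γ : Ctx n} {Ns Ns' : Vec (Tm n) k} {σs : Ctx k} →
                           Ns ⟶v Ns' → Γ ⊢⃗ Ns ∶□ σs → Γ ⊢⃗ Ns' ∶□ σs
    ⟶v-subject-reduction (here r)  (⊢N ∷ ⊢Ns) = subject-reduction r ⊢N ∷ ⊢Ns
    ⟶v-subject-reduction (there r) (⊢N ∷ ⊢Ns) = ⊢N ∷ ⟶v-subject-reduction r ⊢Ns

  data BoxDepth≤ : {n : ℕ} → ℕ → Tm n → Set where
    con : ∀ {B c} → BoxDepth≤ {n} B (con c)
    var : ∀ {B i} → BoxDepth≤ {n} B (var i)
    lam : ∀ {B σ M} → BoxDepth≤ {suc n} B M → BoxDepth≤ B (lam σ M)
    app : ∀ {B M N} → BoxDepth≤ {n} B M → BoxDepth≤ B N → BoxDepth≤ B (app M N)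
    box : ∀ {B b σs} {Ns : Vec (Tm n) k} {M} →
          b < B → BoxDepth≤ b M → All (BoxDepth≤ B) Ns → BoxDepth≤ B (box σs Ns M)

  mutual
    BoxDepth≤-mono : ∀ {B B'} {M : Tm n} → B ≤ B' → BoxDepth≤ B M → BoxDepth≤ B' M
    BoxDepth≤-mono B≤B' con               = con
    BoxDepth≤-mono B≤B' var               = var
    BoxDepth≤-mono B≤B' (lam dM)          = lam (BoxDepth≤-mono B≤B' dM)
    BoxDepth≤-mono B≤B' (app dM dN)       = app (BoxDepth≤-mono B≤B' dM) (BoxDepth≤-mono B≤B' dN)
    BoxDepth≤-mono B≤B' (box b<B dM dNs)  = box (<-≤-trans b<B B≤B') dM (BoxDepth≤*-mono B≤B' dNs)

    BoxDepth≤*-mono : ∀ {B B'} {Ns : Vec (Tm n) k} → B ≤ B' → All (BoxDepth≤ B) Ns → All (BoxDepth≤ B') Ns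
    BoxDepth≤*-mono B≤B' []         = []
    BoxDepth≤*-mono B≤B' (dN ∷ dNs) = BoxDepth≤-mono B≤B' dN ∷ BoxDepth≤*-mono B≤B' dNs

  mutual
    BoxDepth≤-rename : ∀ {B} (ρ : Ren m n) {M} → BoxDepth≤ B M → BoxDepth≤ B (rename ρ M)
    BoxDepth≤-rename ρ con              = con
    BoxDepth≤-rename ρ var              = var
    BoxDepth≤-rename ρ (lam dM)         = lam (BoxDepth≤-rename (ext ρ) dM)
    BoxDepth≤-rename ρ (app dM dN)      = app (BoxDepth≤-rename ρ dM) (BoxDepth≤-rename ρ dN)
    BoxDepth≤-rename ρ (box b<B dM dNs) = box b<B dM (BoxDepth≤*-rename ρ dNs)

    BoxDepth≤*-rename : ∀ {B} (ρ : Ren m n) {Ns : Vec (Tm m) k} →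
                        All (BoxDepth≤ B) Ns → All (BoxDepth≤ B) (renameVec ρ Ns)
    BoxDepth≤*-rename ρ []         = []
    BoxDepth≤*-rename ρ (dN ∷ dNs) = BoxDepth≤-rename ρ dN ∷ BoxDepth≤*-rename ρ dNs

  mutual
    BoxDepth≤-rename⁻ : ∀ {B} (ρ : Ren m n) (M : Tm m) → BoxDepth≤ B (rename ρ M) → BoxDepth≤ B M
    BoxDepth≤-rename⁻ ρ (con c)       con              = con
    BoxDepth≤-rename⁻ ρ (var i)       var              = var
    BoxDepth≤-rename⁻ ρ (lam σ M)     (lam dM)         = lam (BoxDepth≤-rename⁻ (ext ρ) M dM)
    BoxDepth≤-rename⁻ ρ (app M N)     (app dM dN)      = app (BoxDepth≤-rename⁻ ρ M dM) (BoxDepth≤-rename⁻ ρ N dN)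
    BoxDepth≤-rename⁻ ρ (box σs Ns M) (box b<B dM dNs) = box b<B dM (BoxDepth≤*-rename⁻ ρ Ns dNs)

    BoxDepth≤*-rename⁻ : ∀ {B} (ρ : Ren m n) (Ns : Vec (Tm m) k) →
                         All (BoxDepth≤ B) (renameVec ρ Ns) → All (BoxDepth≤ B) Ns
    BoxDepth≤*-rename⁻ ρ []       []         = []
    BoxDepth≤*-rename⁻ ρ (N ∷ Ns) (dN ∷ dNs) = BoxDepth≤-rename⁻ ρ N dN ∷ BoxDepth≤*-rename⁻ ρ Ns dNs

  mutual
    BoxDepth≤-subst : ∀ {B} (s : Sub m n) → (∀ i → BoxDepth≤ B (s i)) →
                      ∀ {M} → BoxDepth≤ B M → BoxDepth≤ B (subst s M)
    BoxDepth≤-subst s ds con              = con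
    BoxDepth≤-subst s ds (var {i = i})    = ds i
    BoxDepth≤-subst s ds (lam dM)         = lam (BoxDepth≤-subst (exts s) dexts dM)
      where dexts : ∀ i → BoxDepth≤ _ (exts s i)
            dexts zero    = var
            dexts (suc i) = BoxDepth≤-rename suc (ds i)
    BoxDepth≤-subst s ds (app dM dN)      = app (BoxDepth≤-subst s ds dM) (BoxDepth≤-subst s ds dN)
    BoxDepth≤-subst s ds (box b<B dM dNs) = box b<B dM (BoxDepth≤*-subst s ds dNs)

    BoxDepth≤*-subst : ∀ {B} (s : Sub m n) → (∀ i → BoxDepth≤ B (s i)) →
                       {Ns : Vec (Tm m) k} → All (BoxDepth≤ B) Ns → All (BoxDepth≤ B) (substVec s Ns)
    BoxDepth≤*-subst s ds []         = []
    BoxDepth≤*-subst s ds (dN ∷ dNs) = BoxDepth≤-subst s ds dN ∷ BoxDepth≤*-subst s ds dNs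

  BoxDepth≤-flatSub : ∀ {a j b B} {N : Tm j} → BoxDepth≤ B N → ∀ i → BoxDepth≤ B (flatSub a j b N i)
  BoxDepth≤-flatSub {a} dN i with splitAt a i
  ... | inj₁ _       = var
  ... | inj₂ zero    = BoxDepth≤-rename _ dN
  ... | inj₂ (suc _) = var

  BoxDepth≤-flatten : ∀ {a j b bM bN} {N : Tm j} {M : Tm (a + suc b)} → BoxDepth≤ bM M → BoxDepth≤ bN N →
                      BoxDepth≤ (bM ⊔ bN) (subst (flatSub a j b N) M)
  BoxDepth≤-flatten {bM = bM} {bN} dM dN =
    BoxDepth≤-subst _ (BoxDepth≤-flatSub (BoxDepth≤-mono (m≤n⊔m bM bN) dN)) (BoxDepth≤-mono (m≤m⊔n bM bN) dM)

  mutual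
    ⟶-BoxDepth≤ : ∀ {B} {M M' : Tm n} → M ⟶ M' → BoxDepth≤ B M → BoxDepth≤ B M'
    ⟶-BoxDepth≤ β                  (app (lam dM) dN) = BoxDepth≤-subst _ dsub0 dM
      where dsub0 : ∀ i → BoxDepth≤ _ (sub0 _ i)
            dsub0 zero    = dN
            dsub0 (suc i) = var
    ⟶-BoxDepth≤ (η {M = M})        (lam (app dM _))  = BoxDepth≤-rename⁻ suc M dM
    ⟶-BoxDepth≤ boxId              (box _ _ (dN ∷ [])) = dN
    ⟶-BoxDepth≤ (boxFlat ws σ zs Ps τs Ls N Qs M) (box bM<B dM dArgs)
      with All.++⁻ Ps dArgs
    ... | dPs , box bN<B dN dLs ∷ dQs =
      box (⊔-lub bM<B bN<B) (BoxDepth≤-flatten dM dN) (All.++⁺ (All.++⁺ dPs dLs) dQs)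
    ⟶-BoxDepth≤ (ξlam r)     (lam dM)         = lam (⟶-BoxDepth≤ r dM)
    ⟶-BoxDepth≤ (ξappl r)    (app dM dN)      = app (⟶-BoxDepth≤ r dM) dN
    ⟶-BoxDepth≤ (ξappr r)    (app dM dN)      = app dM (⟶-BoxDepth≤ r dN)
    ⟶-BoxDepth≤ (ξboxArgs r) (box b<B dM dNs) = box b<B dM (⟶v-BoxDepth≤ r dNs)
    ⟶-BoxDepth≤ (ξboxBody r) (box b<B dM dNs) = box b<B (⟶-BoxDepth≤ r dM) dNs

    ⟶v-BoxDepth≤ : ∀ {B} {Ns Ns' : Vec (Tm n) k} → Ns ⟶v Ns' → All (BoxDepth≤ B) Ns → All (BoxDepth≤ B) Ns'
    ⟶v-BoxDepth≤ (here r)  (dN ∷ dNs) = ⟶-BoxDepth≤ r dN ∷ dNs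
    ⟶v-BoxDepth≤ (there r) (dN ∷ dNs) = dN ∷ ⟶v-BoxDepth≤ r dNs

  mutual
    boxDepth : (M : Tm n) → ∃[ B ] BoxDepth≤ B M
    boxDepth (con c)        = 0 , con
    boxDepth (var i)        = 0 , var
    boxDepth (lam σ M)      with boxDepth M
    ... | B , dM = B , lam dM
    boxDepth (app M N)      with boxDepth M | boxDepth N
    ... | B , dM | B' , dN  = B ⊔ B' , app (BoxDepth≤-mono (m≤m⊔n B B') dM) (BoxDepth≤-mono (m≤n⊔m B B') dN)
    boxDepth (box σs Ns M)  with boxDepth M | boxDepth* Ns
    ... | B , dM | B' , dNs = suc B ⊔ B' , box (m≤m⊔n (suc B) B') dM (BoxDepth≤*-mono (m≤n⊔m (suc B) B') dNs)

    boxDepth* : (Ns : Vec (Tm n) k) → ∃[ B ] All (BoxDepth≤ B) Ns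
    boxDepth* []            = 0 , []
    boxDepth* (N ∷ Ns)      with boxDepth N | boxDepth* Ns
    ... | B , dN | B' , dNs = B ⊔ B' , BoxDepth≤-mono (m≤m⊔n B B') dN ∷ BoxDepth≤*-mono (m≤n⊔m B B') dNs

  SN-at-depth : ℕ → Set
  SN-at-depth B = ∀ {n} {Γ : Ctx n} {M : Tm n} {τ : Ty P} → Γ ⊢ M ∶ τ → BoxDepth≤ B M → SN M

  -- The effect of ξboxArgs and boxFlat on the argument list of a box.
  infix 4 _⇝_
  data _⇝_ {n : ℕ} : List (Tm n) → List (Tm n) → Set where
    step    : ∀ {N N' : Tm n} {Ns} → N ⟶ N' → N ∷ Ns ⇝ N' ∷ Ns
    flatten : ∀ {σs : Ctx k} {Ls : Vec (Tm n) k} {N Ns} → box σs Ls N ∷ Ns ⇝ toList Ls ++ₗ Ns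
    skip    : ∀ {N : Tm n} {Ns Ns'} → Ns ⇝ Ns' → N ∷ Ns ⇝ N ∷ Ns'

  ArgsSN : List (Tm n) → Set
  ArgsSN = Acc (flip _⇝_)

  ⟶v⇒⇝ : {Ns Ns' : Vec (Tm n) k} → Ns ⟶v Ns' → toList Ns ⇝ toList Ns'
  ⟶v⇒⇝ (here r)  = step r
  ⟶v⇒⇝ (there r) = skip (⟶v⇒⇝ r)

  boxFlat⇝ : ∀ {a j b} (Ps : Vec (Tm n) a) {σs : Ctx j} {Ls : Vec (Tm n) j} {N} {Qs : Vec (Tm n) b} →
             toList (Ps ++ box σs Ls N ∷ Qs) ⇝ toList ((Ps ++ Ls) ++ Qs)
  boxFlat⇝ [] {σs} {Ls} {N} {Qs} = transport (box σs Ls N ∷ toList Qs ⇝_) (sym (toList-++ Ls Qs)) flatten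
  boxFlat⇝ (P ∷ Ps)               = skip (boxFlat⇝ Ps)

  data NotBox : Tm n → Set where
    con : ∀ {c} → NotBox {n} (con c)
    var : ∀ {i} → NotBox {n} (var i)
    lam : ∀ {σ M} → NotBox {n} (lam σ M)
    app : ∀ {M N} → NotBox {n} (app M N)

  data Neutral : Tm n → Set where
    con : ∀ {c} → Neutral {n} (con c)
    var : ∀ {i} → Neutral {n} (var i)
    app : ∀ {M N} → Neutral {n} (app M N)

  Neutral⇒NotBox : {M : Tm n} → Neutral M → NotBox M
  Neutral⇒NotBox con = con
  Neutral⇒NotBox var = var
  Neutral⇒NotBox app = app

  -- Red is not closed under weakening, so in Red⇒SN this reducible term of each type
  -- takes the place of the usual fresh variable.
  inhabitant : Ty P → Tm n
  inhabitant (base p) = lam (base p) (var zero)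
  inhabitant (□ τ)    = lam τ (var zero)
  inhabitant (σ ⊃ τ)  = lam σ (weaken (inhabitant τ))

  lam-var-normal : ∀ {σ} {M : Tm n} → ¬ (lam σ (var zero) ⟶ M)
  lam-var-normal (ξlam ())

  module Reducibility (B : ℕ) (SN-below : ∀ {b} → b < B → SN-at-depth b) where

    Body : Ctx k → Tm k → Ty P → Set
    Body σs M τ = σs ⊢ M ∶ τ × ∃[ b ] b < B × BoxDepth≤ b M

    Body⇒SN : ∀ {σs : Ctx k} {M τ} → Body σs M τ → SN M
    Body⇒SN (⊢M , b , b<B , dM) = SN-below b<B ⊢M dM

    ⟶-Body : ∀ {σs : Ctx k} {M M' τ} → M ⟶ M' → Body σs M τ → Body σs M' τ
    ⟶-Body r (⊢M , b , b<B , dM) = subject-reduction r ⊢M , b , b<B , ⟶-BoxDepth≤ r dM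

    Body-flatten : ∀ {a j b} {ws : Ctx a} {σ} {zs : Ctx b} {τs : Ctx j} {N M τ} →
                   Body (ws ++ σ ∷ zs) M τ → Body τs N σ →
                   Body ((ws ++ τs) ++ zs) (subst (flatSub a j b N) M) τ
    Body-flatten {ws = ws} {σ} {zs} {τs} (⊢M , bM , bM<B , dM) (⊢N , bN , bN<B , dN) =
      ⊢-subst (flatSub-⊢ ws σ zs τs ⊢N) ⊢M , bM ⊔ bN , ⊔-lub bM<B bN<B , BoxDepth≤-flatten dM dN

    -- Reducibility at □ τ makes no reference to Red τ: box bodies are covered by Body⇒SN.
    data Red□ {n : ℕ} : Ty P → Tm n → Set where
      not-box : ∀ {τ} {M : Tm n} → NotBox M → (∀ {M'} → M ⟶ M' → Red□ τ M') → Red□ τ M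
      is-box  : ∀ {τ} {σs : Ctx k} {Ns : Vec (Tm n) k} {M} → Body σs M τ → Pointwise Red□ σs Ns →
                (∀ {M'} → box σs Ns M ⟶ M' → Red□ τ M') → Red□ τ (box σs Ns M)

    ⟶-Red□ : ∀ {τ} {M M' : Tm n} → M ⟶ M' → Red□ τ M → Red□ τ M'
    ⟶-Red□ r (not-box _ rs)  = rs r
    ⟶-Red□ r (is-box _ _ rs) = rs r

    Red□⇒SN : ∀ {τ} {M : Tm n} → Red□ τ M → SN M
    Red□⇒SN (not-box _ rs)  = acc λ r → Red□⇒SN (rs r)
    Red□⇒SN (is-box _ _ rs) = acc λ r → Red□⇒SN (rs r)

    ⟶v-Red□ : ∀ {σs : Ctx k} {Ns Ns' : Vec (Tm n) k} → Ns ⟶v Ns' → Pointwise Red□ σs Ns → Pointwise Red□ σs Ns'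
    ⟶v-Red□ (here r)  (rN ∷ rNs) = ⟶-Red□ r rN ∷ rNs
    ⟶v-Red□ (there r) (rN ∷ rNs) = rN ∷ ⟶v-Red□ r rNs

    mutual
      ∷-ArgsSN : ∀ {σ} {N : Tm n} {Ns} → Red□ σ N → ArgsSN Ns → ArgsSN (N ∷ Ns)
      ∷-ArgsSN rN aNs = acc (∷-ArgsSN-step rN aNs)

      ∷-ArgsSN-step : ∀ {σ} {N : Tm n} {Ns Ns'} → Red□ σ N → ArgsSN Ns → N ∷ Ns ⇝ Ns' → ArgsSN Ns'
      ∷-ArgsSN-step (not-box _ rs)    aNs       (step r) = ∷-ArgsSN (rs r) aNs
      ∷-ArgsSN-step (is-box _ _ rs)   aNs       (step r) = ∷-ArgsSN (rs r) aNs
      ∷-ArgsSN-step (not-box () _)    aNs       flatten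
      ∷-ArgsSN-step (is-box _ rLs _)  aNs       flatten  = ++-ArgsSN rLs aNs
      ∷-ArgsSN-step rN                (acc rs)  (skip r) = ∷-ArgsSN rN (rs r)

      ++-ArgsSN : ∀ {σs : Ctx k} {Ls : Vec (Tm n) k} {Ns} → Pointwise Red□ σs Ls → ArgsSN Ns → ArgsSN (toList Ls ++ₗ Ns)
      ++-ArgsSN []         aNs = aNs
      ++-ArgsSN (rL ∷ rLs) aNs = ∷-ArgsSN rL (++-ArgsSN rLs aNs)

    toList-ArgsSN : ∀ {σs : Ctx k} {Ns : Vec (Tm n) k} → Pointwise Red□ σs Ns → ArgsSN (toList Ns)
    toList-ArgsSN []         = acc λ ()
    toList-ArgsSN (rN ∷ rNs) = ∷-ArgsSN rN (toList-ArgsSN rNs)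

    mutual
      box-Red□ : ∀ {σs : Ctx k} {Ns : Vec (Tm n) k} {M τ} →
                 ArgsSN (toList Ns) → Pointwise Red□ σs Ns → Body σs M τ → SN M → Red□ τ (box σs Ns M)
      box-Red□ aNs rNs bM sM = is-box bM rNs (box-Red□-step aNs rNs bM sM)

      box-Red□-step : ∀ {σs : Ctx k} {Ns : Vec (Tm n) k} {M τ M'} →
                      ArgsSN (toList Ns) → Pointwise Red□ σs Ns → Body σs M τ → SN M → box σs Ns M ⟶ M' → Red□ τ M'
      box-Red□-step (acc rs) rNs bM sM (ξboxArgs r) = box-Red□ (rs (⟶v⇒⇝ r)) (⟶v-Red□ r rNs) bM sM
      box-Red□-step aNs rNs bM (acc rs) (ξboxBody r) = box-Red□ aNs rNs (⟶-Body r bM) (rs r)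
      box-Red□-step aNs (rN ∷ []) (tvar zero , _) sM boxId = rN
      box-Red□-step (acc rs) rNs bM sM (boxFlat ws σ zs Ps τs Ls N Qs M)
        with Pointwise.++⁻ ws Ps rNs
      ... | rPs , not-box () _ ∷ rQs
      ... | rPs , is-box bN rLs _ ∷ rQs =
        box-Red□ (rs (boxFlat⇝ Ps)) (Pointwise.++⁺ (Pointwise.++⁺ rPs rLs) rQs) bM' (Body⇒SN bM')
        where bM' = Body-flatten bM bN

    Red : Ty P → Tm n → Set
    Red (base p) M = SN M
    Red (σ ⊃ τ)  M = ∀ N → Red σ N → Red τ (app M N)
    Red (□ τ)    M = Red□ τ M

    ⟶-Red : ∀ σ {M M' : Tm n} → M ⟶ M' → Red σ M → Red σ M'
    ⟶-Red (base p) r (acc rs) = rs r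
    ⟶-Red (σ ⊃ τ)  r rM       = λ N rN → ⟶-Red τ (ξappl r) (rM N rN)
    ⟶-Red (□ τ)    r rM       = ⟶-Red□ r rM

    mutual
      Red⇒SN : ∀ σ {M : Tm n} → Red σ M → SN M
      Red⇒SN (base p) rM = rM
      Red⇒SN (σ ⊃ τ)  rM = SN-appˡ (Red⇒SN τ (rM (inhabitant σ) (inhabitant-Red σ)))
      Red⇒SN (□ τ)    rM = Red□⇒SN rM

      neutral-Red : ∀ σ {M : Tm n} → Neutral M → (∀ {M'} → M ⟶ M' → Red σ M') → Red σ M
      neutral-Red (base p) nM rs      = acc rs
      neutral-Red (σ ⊃ τ)  nM rs N rN = neutral-app-Red σ τ nM rs (Red⇒SN σ rN) rN
      neutral-Red (□ τ)    nM rs      = not-box (Neutral⇒NotBox nM) rs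

      neutral-app-Red : ∀ σ τ {M N : Tm n} → Neutral M → (∀ {M'} → M ⟶ M' → Red (σ ⊃ τ) M') →
                        SN N → Red σ N → Red τ (app M N)
      neutral-app-Red σ τ nM rs sN rN = neutral-Red τ app (neutral-app-step σ τ nM rs sN rN)

      neutral-app-step : ∀ σ τ {M N M' : Tm n} → Neutral M → (∀ {M'} → M ⟶ M' → Red (σ ⊃ τ) M') →
                         SN N → Red σ N → app M N ⟶ M' → Red τ M'
      neutral-app-step σ τ () rs sN       rN β
      neutral-app-step σ τ nM rs sN       rN (ξappl r) = rs r _ rN
      neutral-app-step σ τ nM rs (acc sN) rN (ξappr r) = neutral-app-Red σ τ nM rs (sN r) (⟶-Red σ r rN)

      lam-Red : ∀ σ τ (M : Tm (suc n)) → (∀ N → Red σ N → Red τ (M [0:= N ])) → Red (σ ⊃ τ) (lam σ M)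
      lam-Red σ τ M rM N rN = lam-app-Red σ τ (SN-subst⁻ (sub0 N) (Red⇒SN τ (rM N rN))) (Red⇒SN σ rN) rM rN

      lam-app-Red : ∀ σ τ {M : Tm (suc n)} {N} → SN M → SN N →
                    (∀ N → Red σ N → Red τ (M [0:= N ])) → Red σ N → Red τ (app (lam σ M) N)
      lam-app-Red σ τ sM sN rM rN = neutral-Red τ app (lam-app-step σ τ sM sN rM rN)

      lam-app-step : ∀ σ τ {M : Tm (suc n)} {N M'} → SN M → SN N →
                     (∀ N → Red σ N → Red τ (M [0:= N ])) → Red σ N → app (lam σ M) N ⟶ M' → Red τ M'
      lam-app-step σ τ sM       sN       rM rN β                = rM _ rN
      lam-app-step σ τ (acc sM) sN       rM rN (ξappl (ξlam r)) =
        lam-app-Red σ τ (sM r) sN (λ N' rN' → ⟶-Red τ (⟶-subst (sub0 N') r) (rM N' rN')) rN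
      -- (λx. M₀ x) N →η M₀ N coincides with the β-reduct (M₀ x)[x := N].
      lam-app-step σ τ {N = N} sM sN rM rN (ξappl (η {M = M₀})) =
        transport (Red τ) (cong (λ M → app M N) (weaken-[0:=] M₀ N)) (rM N rN)
      lam-app-step σ τ sM       (acc sN) rM rN (ξappr r)        = lam-app-Red σ τ sM (sN r) rM (⟶-Red σ r rN)

      inhabitant-Red : ∀ σ → Red σ (inhabitant {n} σ)
      inhabitant-Red (base p) = acc λ r → ⊥-elim (lam-var-normal r)
      inhabitant-Red (□ τ)    = not-box lam λ r → ⊥-elim (lam-var-normal r)
      inhabitant-Red (σ ⊃ τ)  = lam-Red σ τ (weaken (inhabitant τ)) λ N _ →
        transport (Red τ) (sym (weaken-[0:=] (inhabitant τ) N)) (inhabitant-Red τ)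

    _⊨_ : Sub m n → Ctx m → Set
    s ⊨ Γ = ∀ i → Red (lookup Γ i) (s i)

    fundamental : {Γ : Ctx m} {M : Tm m} {τ : Ty P} → Γ ⊢ M ∶ τ → BoxDepth≤ B M →
                  (s : Sub m n) → s ⊨ Γ → Red τ (subst s M)
    fundamental (tcon c) _ s ⊨s = neutral-Red (cty c) con λ ()
    fundamental (tvar i) _ s ⊨s = ⊨s i
    fundamental (tlam {σ} {τ} {M} ⊢M) (lam dM) s ⊨s = lam-Red σ τ (subst (exts s) M) λ N rN →
      transport (Red τ) (sym (subst-exts-[0:=] s N M))
        (fundamental ⊢M dM (N ∷ₛ s) λ { zero → rN ; (suc i) → ⊨s i })
    fundamental (tapp ⊢M ⊢N) (app dM dN) s ⊨s = fundamental ⊢M dM s ⊨s _ (fundamental ⊢N dN s ⊨s)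
    fundamental (tbox {σs = σs} {Ns} ⊢M ⊢Ns) (box b<B dM dNs) s ⊨s =
      box-Red□ (toList-ArgsSN rNs) rNs body (Body⇒SN body)
      where body = ⊢M , _ , b<B , dM
            rNs : Pointwise Red□ σs (substVec s Ns)
            rNs = lookup⇒Pointwise λ i → transport (Red□ (lookup σs i)) (sym (lookup-substVec s Ns i))
                                                     (fundamental (⊢Ns i) (All.lookup⁺ dNs i) s ⊨s)

    SN-at-this-depth : SN-at-depth B
    SN-at-this-depth {Γ = Γ} {M} {τ} ⊢M dM =
      transport SN (subst-var M) (Red⇒SN τ (fundamental ⊢M dM var λ i → neutral-Red (lookup Γ i) var λ ()))

  typed⇒SN : {Γ : Ctx n} {M : Tm n} {τ : Ty P} → Γ ⊢ M ∶ τ → SN M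
  typed⇒SN {M = M} ⊢M = let B , dM = boxDepth M in
    <-rec SN-at-depth Reducibility.SN-at-this-depth B ⊢M dM

proposition2 : (P C : Set) (cty : C → Ty P) →
    let open Calculus P C cty in
    ∀ {n : ℕ} (Γ : Vec (Ty P) n) (M : Tm n) (τ : Ty P) →
    Γ ⊢ M ∶ τ →
    ¬ (Σ (ℕ → Tm n) λ f → (f zero ≡ M) × (∀ i → f i ⟶ f (suc i)))
proposition2 P C cty Γ M τ ⊢M = SN⇒¬InfiniteReductionFrom (typed⇒SN ⊢M)
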